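{- Let $n$ be a positive integer and let $v(n)$ denote the maximum, over all tournaments $T$ on $n$ vertices, of $v(T)$, the minimum number of voters needed to generate $T$. Then $v(n)$ is odd.
   Context: Let $A$ be a finite set of $n$ candidates. A voter is a linear order (strict ranking) of $A$, i.e. a permutation $x_1x_2\cdots x_n$ of $A$, where $x_i$ is preferred over $x_j$ iff $i<j$. A nonempty finite multiset $U$ of voters generates a tournament $T$ on vertex set $A$ if for every pair of distinct $a,b\in A$, the arc $(a,b)$ is in $T$ if and only if strictly more than half of the voters in $U$ prefer $a$ over $b$ (in particular, for every pair there is a strict majority in one direction, i.e. no ties). For a tournament $T$, $v(T)$ is the minimum cardinality of a multiset of voters generating $T$ (such a multiset always exists). -}

module Defs where

open import Data.Nat using (ℕ; suc; _+_; _*_; _<_; _≤_)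
open import Data.Fin using (Fin) renaming (_<?_ to _<ᶠ?_; _<_ to _<ᶠ_)
open import Data.Fin.Permutation using (Permutation′; _⟨$⟩ʳ_)
open import Data.List using (List; []; length; filter)
open import Data.Product using (Σ; ∃; _×_)
open import Data.Sum using (_⊎_)
open import Relation.Nullary using (¬_)
open import Relation.Binary.PropositionalEquality using (_≡_; _≢_)
open import Function.Bundles using (_⇔_)

record Tournament (n : ℕ) : Set₁ where
  field
    arc        : Fin n → Fin n → Set
    irrefl     : ∀ a → ¬ arc a a
    total      : ∀ a b → a ≢ b → arc a b ⊎ arc b a
    asym       : ∀ a b → arc a b → ¬ arc b a
open Tournament public

-- A voter = a linear order of the candidates, given as a permutation
-- sending each candidate to its position (0 = most preferred).
Voter : ℕ → Set
Voter n = Permutation′ n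

Prefers : ∀ {n} → Voter n → Fin n → Fin n → Set
Prefers π a b = (π ⟨$⟩ʳ a) <ᶠ (π ⟨$⟩ʳ b)

count : ∀ {n} → List (Voter n) → Fin n → Fin n → ℕ
count U a b = length (filter (λ π → (π ⟨$⟩ʳ a) <ᶠ? (π ⟨$⟩ʳ b)) U)

Generates : ∀ {n} → List (Voter n) → Tournament n → Set
Generates U T = (U ≢ []) ×
  (∀ a b → a ≢ b → (arc T a b ⇔ (length U < 2 * count U a b)))

IsVT : ∀ {n} → Tournament n → ℕ → Set
IsVT T k = (Σ (List (Voter _)) λ U → Generates U T × length U ≡ k)
         × (∀ (U : List (Voter _)) → Generates U T → k ≤ length U)

IsVn : ℕ → ℕ → Set₁
IsVn n m = (Σ (Tournament n) λ T → IsVT T m)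
         × (∀ (T : Tournament n) k → IsVT T k → k ≤ m)

Odd : ℕ → Set
Odd m = ∃ λ k → m ≡ suc (2 * k)

module Submission where

-- v(T) is odd for every tournament T; in particular the maximum v(n) is odd.
--
-- Let U be a minimum generating multiset for T.  It is nonempty, so if |U| were even
-- it would be 2(j+1).  Remove any voter π.  In 2(j+1) votes a strict majority for a
-- over b needs at least j+2 votes, so at least j+1 of the remaining 2j+1 voters still
-- prefer a: majorities survive the removal.  Since, for a ≠ b, the votes for a over b
-- and for b over a add up to the number of voters, no two opposite strict majorities
-- can coexist; hence the smaller multiset generates exactly T, contradicting minimality.

open import Defs
open import Data.Nat using (ℕ; zero; suc; _+_; _*_; _<_; _≤_; _≥_; s≤s⁻¹)
open import Data.Nat.Properties
  using ( *-suc; +-suc; suc-injective; 0≢1+n; n<1+n; n≤1+n; ≤-reflexive; ≤-trans; <-≤-trans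
        ; <-irrefl; ≤⇒≯; +-mono-<; +-identityʳ; *-distribˡ-+; *-monoʳ-≤
        ; *-cancelˡ-<; module ≤-Reasoning )
open import Data.Fin using (Fin) renaming (_<?_ to _<ᶠ?_)
import Data.Fin.Properties as Fin
open import Data.Fin.Permutation using (_⟨$⟩ʳ_)
open import Data.List using (List; []; _∷_; length)
open import Data.List.Properties using (filter-accept; filter-reject)
open import Data.Product using (Σ; _×_; _,_)
open import Data.Sum using (_⊎_; inj₁; inj₂)
open import Data.Empty using (⊥-elim)
open import Relation.Nullary using (¬_; yes; no)
open import Relation.Binary using (tri<; tri≈; tri>)
open import Relation.Binary.PropositionalEquality
  using (_≡_; _≢_; refl; sym; trans; cong; cong₂; subst; ≢-sym)
open import Function.Bundles using (_⇔_; Injection; mk⇔; Equivalence)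
open import Function.Properties.Inverse using (↔⇒↣)

even-or-odd : ∀ m → (Σ ℕ λ k → m ≡ 2 * k) ⊎ Odd m
even-or-odd zero = inj₁ (0 , refl)
even-or-odd (suc m) with even-or-odd m
... | inj₁ (k , m≡2k)  = inj₂ (k , cong suc m≡2k)
... | inj₂ (k , m≡2k+1) = inj₁ (suc k , trans (cong suc m≡2k+1) (sym (*-suc 2 k)))

positions-distinct : ∀ {n} (π : Voter n) {a b : Fin n} → a ≢ b → π ⟨$⟩ʳ a ≢ π ⟨$⟩ʳ b
positions-distinct π a≢b same = a≢b (Injection.injective (↔⇒↣ π) same)

count-cons-prefers : ∀ {n} (π : Voter n) U {a b} →
                     Prefers π a b → count (π ∷ U) a b ≡ suc (count U a b)
count-cons-prefers π U {a} {b} p =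
  cong length (filter-accept (λ σ → (σ ⟨$⟩ʳ a) <ᶠ? (σ ⟨$⟩ʳ b)) {π} {U} p)

count-cons-rejects : ∀ {n} (π : Voter n) U {a b} →
                     ¬ Prefers π a b → count (π ∷ U) a b ≡ count U a b
count-cons-rejects π U {a} {b} ¬p =
  cong length (filter-reject (λ σ → (σ ⟨$⟩ʳ a) <ᶠ? (σ ⟨$⟩ʳ b)) {π} {U} ¬p)

count-cons-≤ : ∀ {n} (π : Voter n) U a b → count (π ∷ U) a b ≤ suc (count U a b)
count-cons-≤ π U a b with (π ⟨$⟩ʳ a) <ᶠ? (π ⟨$⟩ʳ b)
... | yes p = ≤-reflexive (count-cons-prefers π U p)
... | no ¬p = ≤-trans (≤-reflexive (count-cons-rejects π U ¬p)) (n≤1+n _)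

-- For distinct a, b every voter prefers exactly one of them, so the two counts add up
-- to the size of the electorate.
count-complement : ∀ {n} (U : List (Voter n)) {a b} → a ≢ b →
                   count U a b + count U b a ≡ length U
count-complement [] a≢b = refl
count-complement (π ∷ U) {a} {b} a≢b with Fin.<-cmp (π ⟨$⟩ʳ a) (π ⟨$⟩ʳ b)
... | tri< a<b _ _ =
  trans (cong₂ _+_ (count-cons-prefers π U a<b) (count-cons-rejects π U (Fin.<-asym a<b)))
        (cong suc (count-complement U a≢b))
... | tri≈ _ a=b _ = ⊥-elim (positions-distinct π a≢b a=b)
... | tri> _ _ b<a =
  trans (cong₂ _+_ (count-cons-rejects π U (Fin.<-asym b<a)) (count-cons-prefers π U b<a))
        (trans (+-suc _ _) (cong suc (count-complement U a≢b)))

majorities-exclusive : ∀ {n} (U : List (Voter n)) {a b} → a ≢ b →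
                       length U < 2 * count U a b → ¬ (length U < 2 * count U b a)
majorities-exclusive U {a} {b} a≢b ab ba = <-irrefl refl L+L<L+L
  where
  open ≤-Reasoning
  L = length U
  L+L<L+L : L + L < L + L
  L+L<L+L = begin-strict
    L + L                             <⟨ +-mono-< ab ba ⟩
    2 * count U a b + 2 * count U b a ≡⟨ sym (*-distribˡ-+ 2 (count U a b) (count U b a)) ⟩
    2 * (count U a b + count U b a)   ≡⟨ cong (2 *_) (count-complement U a≢b) ⟩
    2 * L                             ≡⟨ cong (L +_) (+-identityʳ L) ⟩
    L + L                             ∎

-- Arithmetic core: a strict majority of 2(j+1) votes is at least j+2 votes, so after
-- losing one vote at least j+1 remain, still a strict majority of 2j+1.
even-majority-loses-one : ∀ j c → 2 * suc j < 2 * suc c → suc (2 * j) < 2 * c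
even-majority-loses-one j c h = begin-strict
  suc (2 * j) <⟨ n<1+n _ ⟩
  2 + 2 * j   ≡⟨ sym (*-suc 2 j) ⟩
  2 * suc j   ≤⟨ *-monoʳ-≤ 2 (s≤s⁻¹ (*-cancelˡ-< 2 (suc j) (suc c) h)) ⟩
  2 * c       ∎
  where open ≤-Reasoning

majority-survives-removal : ∀ {n} (π : Voter n) U j {a b} → length U ≡ suc (2 * j) →
  length (π ∷ U) < 2 * count (π ∷ U) a b → length U < 2 * count U a b
majority-survives-removal π U j {a} {b} |U|≡2j+1 maj =
  subst (_< 2 * count U a b) (sym |U|≡2j+1) (even-majority-loses-one j (count U a b) maj′)
  where
  |π∷U|≡2j+2 : length (π ∷ U) ≡ 2 * suc j
  |π∷U|≡2j+2 = trans (cong suc |U|≡2j+1) (sym (*-suc 2 j))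
  maj′ : 2 * suc j < 2 * suc (count U a b)
  maj′ = <-≤-trans (subst (_< 2 * count (π ∷ U) a b) |π∷U|≡2j+2 maj)
                   (*-monoʳ-≤ 2 (count-cons-≤ π U a b))

-- Hence dropping a voter from an even generating multiset still generates the tournament:
-- arcs keep their majorities, and non-arcs cannot gain one because the reverse arc keeps its own.
drop-voter-generates : ∀ {n} {T : Tournament n} (π : Voter n) U j →
  length U ≡ suc (2 * j) → Generates (π ∷ U) T → Generates U T
drop-voter-generates {T = T} π U j |U|≡2j+1 (_ , generates) = U≢[] , generates′
  where
  U≢[] : U ≢ []
  U≢[] U≡[] = 0≢1+n (trans (sym (cong length U≡[])) |U|≡2j+1)
  arc⇒majority : ∀ a b → a ≢ b → arc T a b → length U < 2 * count U a b
  arc⇒majority a b a≢b ab =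
    majority-survives-removal π U j |U|≡2j+1 (Equivalence.to (generates a b a≢b) ab)
  majority⇒arc : ∀ a b → a ≢ b → length U < 2 * count U a b → arc T a b
  majority⇒arc a b a≢b maj with total T a b a≢b
  ... | inj₁ ab = ab
  ... | inj₂ ba = ⊥-elim (majorities-exclusive U a≢b maj (arc⇒majority b a (≢-sym a≢b) ba))
  generates′ : ∀ a b → a ≢ b → (arc T a b ⇔ (length U < 2 * count U a b))
  generates′ a b a≢b = mk⇔ (arc⇒majority a b a≢b) (majority⇒arc a b a≢b)

even-generator-shrinks : ∀ {n} {T : Tournament n} (U : List (Voter n)) j →
  Generates U T → length U ≡ 2 * j →
  Σ (List (Voter n)) λ V → Generates V T × length V < length U
even-generator-shrinks []      j       (U≢[] , _) _ = ⊥-elim (U≢[] refl)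
even-generator-shrinks (π ∷ U) zero    _ ()
even-generator-shrinks {T = T} (π ∷ U) (suc j) generates |π∷U|≡2j+2 =
  U , drop-voter-generates {T = T} π U j |U|≡2j+1 generates , n<1+n (length U)
  where
  |U|≡2j+1 : length U ≡ suc (2 * j)
  |U|≡2j+1 = suc-injective (trans |π∷U|≡2j+2 (*-suc 2 j))

vt-odd : ∀ {n} (T : Tournament n) k → IsVT T k → Odd k
vt-odd T k ((U , generates , |U|≡k) , minimum) with even-or-odd k
... | inj₂ k-odd = k-odd
... | inj₁ (j , k≡2j) with even-generator-shrinks {T = T} U j generates (trans |U|≡k k≡2j)
...   | V , V-generates , |V|<|U| =
  ⊥-elim (≤⇒≯ (minimum V V-generates) (subst (length V <_) |U|≡k |V|<|U|))

-- The theorem: v(n) is v(T) for a tournament T on n vertices, hence odd.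
lemma1 : ∀ (n m : ℕ) → n ≥ 1 → IsVn n m → Odd m
lemma1 n m _ ((T , m-is-vT) , _) = vt-odd T m m-is-vT
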